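{- Let $K$ be a field, $G\le K^\times$ a multiplicative subgroup with $G\neq K^\times$ and $-1\in G$, $T:=G+1$, and $\mathcal{N}_G:=\{\bigcap_{i=1}^n a_i\cdot T: n\in\mathbb{N}, a_1,\dots,a_n\in K^\times\}$. If there exists $V\in\mathcal{N}_G$ with $V\cdot V\subseteq T$, then for every $U\in\mathcal{N}_G$ there exists $V\in\mathcal{N}_G$ with $V\cdot V\subseteq U$.
   Context: $G+1=\{g+1:g\in G\}$, $a\cdot X=\{ax:x\in X\}$, $V\cdot V=\{xy:x,y\in V\}$. -}

module Defs where

open import Level using (Level; _⊔_; suc)
open import Algebra.Bundles using (CommutativeRing)
open import Data.Nat using (ℕ)
open import Data.Fin using (Fin)
open import Data.Product using (Σ; ∃; _×_; _,_)
open import Relation.Nullary using (¬_)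

record Field (c ℓ : Level) : Set (suc (c ⊔ ℓ)) where
  field
    commutativeRing : CommutativeRing c ℓ
  open CommutativeRing commutativeRing public
  field
    1≉0     : ¬ (1# ≈ 0#)
    inverse : ∀ x → ¬ (x ≈ 0#) → ∃ λ y → x * y ≈ 1#

module FieldNotions {c ℓ : Level} (K : Field c ℓ) where
  open Field K

  Subset : Set (suc (c ⊔ ℓ))
  Subset = Carrier → Set (c ⊔ ℓ)

  _⊆_ : Subset → Subset → Set (c ⊔ ℓ)
  X ⊆ Y = ∀ x → X x → Y x

  Unit : Carrier → Set ℓ
  Unit x = ¬ (x ≈ 0#)

  record IsMulSubgroup (G : Subset) : Set (c ⊔ ℓ) where
    field
      respects : ∀ {x y} → x ≈ y → G x → G y
      ⊆units   : ∀ x → G x → Unit x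
      one      : G 1#
      mul      : ∀ x y → G x → G y → G (x * y)
      inv      : ∀ x y → G x → x * y ≈ 1# → G y

  shift1 : Subset → Subset
  shift1 G x = ∃ λ g → G g × x ≈ g + 1#

  scale : Carrier → Subset → Subset
  scale a X y = ∃ λ x → X x × y ≈ a * x

  prodSet : Subset → Subset
  prodSet V z = ∃ λ x → ∃ λ y → V x × V y × z ≈ x * y

  bigInter : (n : ℕ) → (Fin n → Carrier) → Subset → Subset
  bigInter n a X y = ∀ i → scale (a i) X y

  In𝒩 : Subset → Subset → Set (c ⊔ ℓ)
  In𝒩 G V = Σ ℕ λ n → Σ (Fin n → Carrier) λ a →
              (∀ i → Unit (a i)) ×
              (V ⊆ bigInter n a (shift1 G)) × (bigInter n a (shift1 G) ⊆ V)

-- Let U = ⋂ aᵢ·T and let V ∈ 𝒩_G with V·V ⊆ T. Since 𝒩_G is closed under finite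
-- intersections and under scaling by units, V' := V ∩ ⋂ aᵢ·V lies in 𝒩_G. For
-- x, y ∈ V' and each i write y = aᵢv with v ∈ V; then xy = aᵢ(xv) ∈ aᵢ·(V·V) ⊆ aᵢ·T,
-- so xy ∈ U.
module Submission where

open import Defs
open import Level using (Level; _⊔_)
open import Data.Nat using (zero; suc) renaming (_+_ to _+ℕ_)
open import Data.Fin using (Fin) renaming (zero to fzero; suc to fsuc)
open import Data.Product using (∃; _×_; _,_)
open import Data.Vec.Functional using (_++_)
open import Data.Vec.Functional.Relation.Unary.All.Properties using (++⁺; ++⁻)
open import Relation.Nullary using (¬_)
import Algebra.Properties.CommutativeSemigroup as CommutativeSemigroupProperties
import Relation.Binary.Reasoning.Setoid as SetoidReasoning

module FieldSubsets {c ℓ : Level} (K : Field c ℓ) where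
  open Field K
  open FieldNotions K
  open CommutativeSemigroupProperties *-commutativeSemigroup using (x∙yz≈y∙xz)
  open SetoidReasoning setoid

  Closed : Subset → Set (c ⊔ ℓ)
  Closed X = ∀ {x y} → x ≈ y → X x → X y

  _∩_ : Subset → Subset → Subset
  (X ∩ Y) x = X x × Y x

  ⋂ : ∀ {n} → (Fin n → Subset) → Subset
  ⋂ X x = ∀ i → X i x

  inverse-cancelˡ : ∀ {a a′} → a′ * a ≈ 1# → ∀ x → a′ * (a * x) ≈ x
  inverse-cancelˡ {a} {a′} a′a≈1 x = begin
    a′ * (a * x)  ≈⟨ *-assoc a′ a x ⟨
    (a′ * a) * x  ≈⟨ *-congʳ a′a≈1 ⟩
    1# * x        ≈⟨ *-identityˡ x ⟩
    x             ∎

  *-preserves-Unit : ∀ {a b} → Unit a → Unit b → Unit (a * b)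
  *-preserves-Unit {a} {b} ua ub ab≈0 with inverse a ua
  ... | a′ , aa′≈1 = ub (begin
    b             ≈⟨ inverse-cancelˡ (trans (*-comm a′ a) aa′≈1) b ⟨
    a′ * (a * b)  ≈⟨ *-congˡ ab≈0 ⟩
    a′ * 0#       ≈⟨ zeroʳ a′ ⟩
    0#            ∎)

  scale-closed : ∀ a X → Closed (scale a X)
  scale-closed a X x≈y (t , Xt , x≈at) = t , Xt , trans (sym x≈y) x≈at

  scale-mono : ∀ {a X Y} → X ⊆ Y → scale a X ⊆ scale a Y
  scale-mono X⊆Y y (x , Xx , y≈ax) = x , X⊆Y x Xx , y≈ax

  scale-* : ∀ a b X → scale (a * b) X ⊆ scale a (scale b X)
  scale-* a b X y (t , Xt , y≈abt) = b * t , (t , Xt , refl) , trans y≈abt (*-assoc a b t)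

  scale-*⁻ : ∀ a b X → scale a (scale b X) ⊆ scale (a * b) X
  scale-*⁻ a b X y (x , (t , Xt , x≈bt) , y≈ax) =
    t , Xt , trans y≈ax (trans (*-congˡ x≈bt) (sym (*-assoc a b t)))

  -- The common preimage a⁻¹y is only ≈ to each witness, hence closedness.
  scale-⋂ : ∀ {n a} → Unit a → (X : Fin n → Subset) → (∀ i → Closed (X i)) →
            ⋂ (λ i → scale a (X i)) ⊆ scale a (⋂ X)
  scale-⋂ {a = a} ua X closed y y∈aX with inverse a ua
  ... | a′ , aa′≈1 = a′ * y , preimage∈X , sym (inverse-cancelˡ aa′≈1 y)
    where
    preimage∈X : ⋂ X (a′ * y)
    preimage∈X i with y∈aX i
    ... | x , Xx , y≈ax =
      closed i (sym (trans (*-congˡ y≈ax) (inverse-cancelˡ (trans (*-comm a′ a) aa′≈1) x))) Xx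

  prodSet-scale : ∀ {V W a x y} → prodSet V ⊆ W → V x → scale a V y → scale a W (x * y)
  prodSet-scale {a = a} {x} {y} VV⊆W Vx (v , Vv , y≈av) =
    x * v , VV⊆W (x * v) (x , v , Vx , Vv , refl) , trans (*-congˡ y≈av) (x∙yz≈y∙xz x a v)

  module _ (G : Subset) where

    In𝒩-cong : ∀ {X Y} → In𝒩 G X → X ⊆ Y → Y ⊆ X → In𝒩 G Y
    In𝒩-cong (n , a , ua , X⊆ , ⊆X) X⊆Y Y⊆X =
      n , a , ua , (λ y Yy → X⊆ y (Y⊆X y Yy)) , (λ y y∈ → X⊆Y y (⊆X y y∈))

    In𝒩-∩ : ∀ {X Y} → In𝒩 G X → In𝒩 G Y → In𝒩 G (X ∩ Y)
    In𝒩-∩ (n , a , ua , X⊆ , ⊆X) (m , b , ub , Y⊆ , ⊆Y) =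
      n +ℕ m , a ++ b , ++⁺ Unit ua ub ,
      (λ y (Xy , Yy) → ++⁺ (λ t → scale t (shift1 G) y) (X⊆ y Xy) (Y⊆ y Yy)) ,
      λ y y∈ → let y∈a , y∈b = ++⁻ (λ t → scale t (shift1 G) y) a y∈ in ⊆X y y∈a , ⊆Y y y∈b

    In𝒩-⋂ : ∀ n (X : Fin n → Subset) → (∀ i → In𝒩 G (X i)) → In𝒩 G (⋂ X)
    In𝒩-⋂ zero    X X∈𝒩 = 0 , (λ ()) , (λ ()) , (λ _ _ ()) , (λ _ _ ())
    In𝒩-⋂ (suc n) X X∈𝒩 =
      In𝒩-cong (In𝒩-∩ (X∈𝒩 fzero) (In𝒩-⋂ n (λ i → X (fsuc i)) (λ i → X∈𝒩 (fsuc i))))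
        (λ { y (Xy , _) fzero → Xy ; y (_ , Xy) (fsuc i) → Xy i })
        (λ y Xy → Xy fzero , λ i → Xy (fsuc i))

    In𝒩-scale : ∀ {a X} → Unit a → In𝒩 G X → In𝒩 G (scale a X)
    In𝒩-scale {a} ua (n , b , ub , X⊆ , ⊆X) =
      n , (λ i → a * b i) , (λ i → *-preserves-Unit ua (ub i)) ,
      (λ y (x , Xx , y≈ax) i → scale-*⁻ a (b i) (shift1 G) y (x , X⊆ x Xx i , y≈ax)) ,
      λ y y∈ → scale-mono ⊆X y
        (scale-⋂ ua (λ i → scale (b i) (shift1 G)) (λ i → scale-closed (b i) (shift1 G)) y
          (λ i → scale-* a (b i) (shift1 G) y (y∈ i)))

lemma4p4 : {c ℓ : Level} (K : Field c ℓ) →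
    let open Field K
        open FieldNotions K
    in (G : Subset) → IsMulSubgroup G →
       ¬ (∀ x → Unit x → G x) →
       G (- 1#) →
       (∃ λ V → In𝒩 G V × (prodSet V ⊆ shift1 G)) →
       (U : Subset) → In𝒩 G U →
       ∃ λ V → In𝒩 G V × (prodSet V ⊆ U)
lemma4p4 K G _ _ _ (V , V∈𝒩 , VV⊆T) U (n , a , ua , _ , ⊆U) =
  V ∩ ⋂ (λ i → scale (a i) V) ,
  In𝒩-∩ G V∈𝒩 (In𝒩-⋂ G n _ (λ i → In𝒩-scale G (ua i) V∈𝒩)) ,
  λ z (x , y , (Vx , _) , (_ , y∈aV) , z≈xy) →
    ⊆U z λ i → scale-closed (a i) (shift1 G) (sym z≈xy) (prodSet-scale VV⊆T Vx (y∈aV i))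
  where
  open Field K
  open FieldNotions K
  open FieldSubsets K
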